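{- Let $\langle A,\succ,1\rangle$ be a distributive bounded G-algebra with least element $0$. Define $x\vee y=(x\succ y)\succ y$, $\sim x=x\succ 0$ and $x\wedge y=\sim(\sim x\vee\sim y)$. Then $\langle A,\vee,\wedge,\sim,1\rangle$ is a De Morgan algebra, i.e. $(A,\vee,\wedge)$ is a distributive lattice with greatest element $1$, $\sim\sim x=x$ and $\sim(x\vee y)=\sim x\wedge\sim y$ for all $x,y\in A$.
   Context: A G-algebra is an algebra $\langle A,\succ,1\rangle$ of type $(2,0)$ satisfying for all $x,y,z$: (G1) $1\succ x=x$; (G2) $x\succ 1=1$; (G3) $(x\succ y)\succ y=(y\succ x)\succ x$; (G4) if $x\succ(y\succ z)=1$ then $y\succ(x\succ z)=1$. The relation $x\leq y$ iff $x\succ y=1$ is a partial order. A G-algebra is bounded if there is $0\in A$ with $0\leq x$ for all $x$. A bounded G-algebra is distributive if for all $x,y,z$: $(x\wedge y)\succ z\leq (x\succ z)\vee(y\succ z)$, where $\vee,\wedge$ are as defined in the claim. -}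

module Defs where

open import Level using (Level; suc)
open import Relation.Binary.PropositionalEquality using (_≡_)
open import Algebra.Lattice.Structures using (IsDistributiveLattice)

record GAlgebra (a : Level) : Set (suc a) where
  infixr 5 _≻_
  field
    Carrier : Set a
    _≻_     : Carrier → Carrier → Carrier
    𝟙       : Carrier
    G1 : ∀ x → 𝟙 ≻ x ≡ x
    G2 : ∀ x → x ≻ 𝟙 ≡ 𝟙
    G3 : ∀ x y → (x ≻ y) ≻ y ≡ (y ≻ x) ≻ x
    G4 : ∀ x y z → x ≻ (y ≻ z) ≡ 𝟙 → y ≻ (x ≻ z) ≡ 𝟙

  _≤_ : Carrier → Carrier → Set a
  x ≤ y = x ≻ y ≡ 𝟙

module GOps {a : Level} (G : GAlgebra a) (𝟘 : GAlgebra.Carrier G) where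
  open GAlgebra G

  _∨_ : Carrier → Carrier → Carrier
  x ∨ y = (x ≻ y) ≻ y

  ∼_ : Carrier → Carrier
  ∼ x = x ≻ 𝟘

  _∧_ : Carrier → Carrier → Carrier
  x ∧ y = ∼ ((∼ x) ∨ (∼ y))

  IsLeast : Set a
  IsLeast = ∀ x → 𝟘 ≤ x

  IsDistributiveG : Set a
  IsDistributiveG = ∀ x y z → ((x ∧ y) ≻ z) ≤ ((x ≻ z) ∨ (y ≻ z))

  record IsDeMorgan : Set a where
    field
      isDistributiveLattice : IsDistributiveLattice _≡_ _∨_ _∧_
      top        : ∀ x → x ∨ 𝟙 ≡ 𝟙
      involutive : ∀ x → ∼ (∼ x) ≡ x
      deMorgan   : ∀ x y → ∼ (x ∨ y) ≡ (∼ x) ∧ (∼ y)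

-- Under the order x ≤ y ⇔ x ≻ y = 1, every G-algebra is a join semilattice
-- with x ∨ y = (x ≻ y) ≻ y as join.  If 0 is least, then ∼ x = x ≻ 0 is an
-- order-reversing involution (∼∼x = (x ≻ 0) ≻ 0 = x ∨ 0 = x), so it carries
-- joins to meets and x ∧ y = ∼(∼x ∨ ∼y) is the meet; De Morgan's law then holds
-- by construction.  The distributivity axiom yields x ∧ (y ∨ z) ≤ (x ∧ y) ∨ z,
-- and in any lattice that inequality already forces distributivity.
module Submission where

open import Level using (Level)
open import Data.Product using (_,_)
open import Relation.Binary.PropositionalEquality
  using (_≡_; refl; sym; trans; cong; cong₂; subst; isEquivalence)
open import Relation.Binary.Structures using (IsPartialOrder)
open import Relation.Binary.Lattice.Definitions using (Supremum; Infimum)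
open import Relation.Binary.Lattice.Structures using (IsJoinSemilattice)
open import Relation.Binary.Lattice.Bundles using (Lattice; DistributiveLattice)
open import Algebra.Definitions using (_DistributesOverˡ_)
import Algebra.Lattice.Structures as Alg
import Relation.Binary.Reasoning.PartialOrder as ≤-Reasoning
open import Defs

module ShiftDistributivity {c ℓ₁ ℓ₂} (L : Lattice c ℓ₁ ℓ₂) where
  open Lattice L renaming (refl to ≤-refl)
  open import Relation.Binary.Lattice.Properties.JoinSemilattice joinSemilattice
    using (∨-comm)
  open import Relation.Binary.Lattice.Properties.MeetSemilattice meetSemilattice
    using (∧-cong; ∧-monotonic)
  open ≤-Reasoning poset

  shift⇒∧-distribˡ-∨ : (∀ x y z → x ∧ (y ∨ z) ≤ (x ∧ y) ∨ z) →
                       _DistributesOverˡ_ _≈_ _∧_ _∨_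
  shift⇒∧-distribˡ-∨ shift x y z = antisym ≤-distrib distrib-≤
    where
    ≤-distrib : x ∧ (y ∨ z) ≤ (x ∧ y) ∨ (x ∧ z)
    ≤-distrib = begin
      x ∧ (y ∨ z)          ≤⟨ ∧-greatest (x∧y≤x x (y ∨ z)) (shift x y z) ⟩
      x ∧ ((x ∧ y) ∨ z)    ≈⟨ ∧-cong Eq.refl (∨-comm (x ∧ y) z) ⟩
      x ∧ (z ∨ (x ∧ y))    ≤⟨ shift x z (x ∧ y) ⟩
      (x ∧ z) ∨ (x ∧ y)    ≈⟨ ∨-comm (x ∧ z) (x ∧ y) ⟩
      (x ∧ y) ∨ (x ∧ z)    ∎

    distrib-≤ : (x ∧ y) ∨ (x ∧ z) ≤ x ∧ (y ∨ z)
    distrib-≤ = ∨-least (∧-monotonic ≤-refl (x≤x∨y y z)) (∧-monotonic ≤-refl (y≤x∨y y z))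

module _ {c ℓ₁ ℓ₂} (D : DistributiveLattice c ℓ₁ ℓ₂) where
  open DistributiveLattice D
  open import Relation.Binary.Lattice.Properties.Lattice lattice using (isAlgLattice)
  open import Relation.Binary.Lattice.Properties.DistributiveLattice D
    using (∨-distrib-∧; ∧-distrib-∨)

  isAlgDistributiveLattice : Alg.IsDistributiveLattice _≈_ _∨_ _∧_
  isAlgDistributiveLattice = record
    { isLattice   = isAlgLattice
    ; ∨-distrib-∧ = ∨-distrib-∧
    ; ∧-distrib-∨ = ∧-distrib-∨
    }

module GAlgebraProperties {a : Level} (G : GAlgebra a) where
  open GAlgebra G

  x≻x≡𝟙 : ∀ x → x ≻ x ≡ 𝟙
  x≻x≡𝟙 x = trans (cong (_≻ x) (sym (G1 x)))
              (trans (G3 𝟙 x) (trans (cong (_≻ 𝟙) (G2 x)) (G2 𝟙)))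

  ≤-refl : ∀ {x} → x ≤ x
  ≤-refl {x} = x≻x≡𝟙 x

  ≤-exchange : ∀ {x y z} → x ≤ (y ≻ z) → y ≤ (x ≻ z)
  ≤-exchange {x} {y} {z} = G4 x y z

  y≤z⇒[z≻y]≻y≡z : ∀ {y z} → y ≤ z → (z ≻ y) ≻ y ≡ z
  y≤z⇒[z≻y]≻y≡z {y} {z} y≤z = trans (G3 z y) (trans (cong (_≻ z) y≤z) (G1 z))

  ≤-antisym : ∀ {x y} → x ≤ y → y ≤ x → x ≡ y
  ≤-antisym {x} {y} x≤y y≤x =
    trans (sym (y≤z⇒[z≻y]≻y≡z y≤x)) (trans (G3 x y) (y≤z⇒[z≻y]≻y≡z x≤y))

  x≤y≻x : ∀ x y → x ≤ (y ≻ x)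
  x≤y≻x x y = ≤-exchange (trans (cong (y ≻_) (x≻x≡𝟙 x)) (G2 y))

  x≤[x≻y]≻y : ∀ x y → x ≤ ((x ≻ y) ≻ y)
  x≤[x≻y]≻y x y = ≤-exchange (x≻x≡𝟙 (x ≻ y))

  -- As x ≻ y = 1, z ≻ y ≤ x ≻ y; exchanging gives x ≤ (z ≻ y) ≻ y, which is z as y ≤ z.
  ≤-trans : ∀ {x y z} → x ≤ y → y ≤ z → x ≤ z
  ≤-trans {x} {y} {z} x≤y y≤z =
    subst (x ≤_) (y≤z⇒[z≻y]≻y≡z y≤z)
      (≤-exchange (trans (cong ((z ≻ y) ≻_) x≤y) (G2 (z ≻ y))))

  ≻-antitoneˡ : ∀ {x y} z → x ≤ y → (y ≻ z) ≤ (x ≻ z)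
  ≻-antitoneˡ {x} {y} z x≤y = ≤-exchange (≤-trans x≤y (x≤[x≻y]≻y y z))

  ≤-isPartialOrder : IsPartialOrder _≡_ _≤_
  ≤-isPartialOrder = record
    { isPreorder = record
      { isEquivalence = isEquivalence
      ; reflexive     = λ { refl → ≤-refl }
      ; trans         = ≤-trans
      }
    ; antisym = ≤-antisym
    }

  isJoinSemilattice : IsJoinSemilattice _≡_ _≤_ (λ x y → (x ≻ y) ≻ y)
  isJoinSemilattice = record
    { isPartialOrder = ≤-isPartialOrder
    ; supremum       = λ x y → x≤[x≻y]≻y x y , x≤y≻x y (x ≻ y) , least x y
    }
    where
    least : ∀ x y z → x ≤ z → y ≤ z → ((x ≻ y) ≻ y) ≤ z
    least x y z x≤z y≤z =
      subst (_≤ z) (sym (G3 x y))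
        (subst (((y ≻ x) ≻ x) ≤_) (y≤z⇒[z≻y]≻y≡z x≤z)
          (≻-antitoneˡ x (≻-antitoneˡ x y≤z)))

module BoundedGAlgebraProperties {a : Level} (G : GAlgebra a) (𝟘 : GAlgebra.Carrier G)
                                 (least : GOps.IsLeast G 𝟘) where
  open GAlgebra G
  open GOps G 𝟘
  open GAlgebraProperties G
  open IsJoinSemilattice isJoinSemilattice using (x≤x∨y; y≤x∨y; ∨-least)

  ∼-involutive : ∀ x → ∼ (∼ x) ≡ x
  ∼-involutive x = y≤z⇒[z≻y]≻y≡z (least x)

  ∼-antitone : ∀ {x y} → x ≤ y → (∼ y) ≤ (∼ x)
  ∼-antitone = ≻-antitoneˡ 𝟘

  ∼-contrapose : ∀ {x y} → (∼ x) ≤ y → (∼ y) ≤ x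
  ∼-contrapose {x} {y} ∼x≤y = subst ((∼ y) ≤_) (∼-involutive x) (∼-antitone ∼x≤y)

  ∧-infimum : Infimum _≤_ _∧_
  ∧-infimum x y =
    ∼-contrapose (x≤x∨y (∼ x) (∼ y)) ,
    ∼-contrapose (y≤x∨y (∼ x) (∼ y)) ,
    λ z z≤x z≤y → ≤-exchange (∨-least (∼-antitone z≤x) (∼-antitone z≤y))

  lattice : Lattice a a a
  lattice = record
    { isLattice = record
      { isPartialOrder = ≤-isPartialOrder
      ; supremum       = IsJoinSemilattice.supremum isJoinSemilattice
      ; infimum        = ∧-infimum
      }
    }

  -- With m = x ∧ (y ∨ z), both x ≻ z and y ≻ z lie below m ≻ z, so the
  -- distributivity axiom gives (x ∧ y) ≻ z ≤ m ≻ z; exchanging yields m ≤ (x ∧ y) ∨ z.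
  ∧-∨-shift : IsDistributiveG → ∀ x y z → (x ∧ (y ∨ z)) ≤ ((x ∧ y) ∨ z)
  ∧-∨-shift dist x y z = ≤-exchange (≤-trans (dist x y z) (∨-least x≻z≤m≻z y≻z≤m≻z))
    where
    open Lattice lattice using (x∧y≤x; x∧y≤y)
    m : Carrier
    m = x ∧ (y ∨ z)

    x≻z≤m≻z : (x ≻ z) ≤ (m ≻ z)
    x≻z≤m≻z = ≻-antitoneˡ z (x∧y≤x x (y ∨ z))

    y≻z≤m≻z : (y ≻ z) ≤ (m ≻ z)
    y≻z≤m≻z = ≤-trans (x≤[x≻y]≻y (y ≻ z) z) (≻-antitoneˡ z (x∧y≤y x (y ∨ z)))

  distributiveLattice : IsDistributiveG → DistributiveLattice a a a
  distributiveLattice dist = record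
    { isDistributiveLattice = record
      { isLattice    = Lattice.isLattice lattice
      ; ∧-distribˡ-∨ = ShiftDistributivity.shift⇒∧-distribˡ-∨ lattice (∧-∨-shift dist)
      }
    }

  x∨𝟙≡𝟙 : ∀ x → x ∨ 𝟙 ≡ 𝟙
  x∨𝟙≡𝟙 x = G2 (x ≻ 𝟙)

  ∼-distrib-∨ : ∀ x y → ∼ (x ∨ y) ≡ (∼ x) ∧ (∼ y)
  ∼-distrib-∨ x y = cong ∼_ (sym (cong₂ _∨_ (∼-involutive x) (∼-involutive y)))

theorem2p8 : {a : Level} (G : GAlgebra a) (𝟘 : GAlgebra.Carrier G) →
    GOps.IsLeast G 𝟘 → GOps.IsDistributiveG G 𝟘 → GOps.IsDeMorgan G 𝟘
theorem2p8 G 𝟘 least dist = record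
  { isDistributiveLattice = isAlgDistributiveLattice (distributiveLattice dist)
  ; top                   = x∨𝟙≡𝟙
  ; involutive            = ∼-involutive
  ; deMorgan              = ∼-distrib-∨
  }
  where open BoundedGAlgebraProperties G 𝟘 least
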